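{- Let $\Sigma$ and $\Gamma$ be fixed finite sets and let $S$ be a colored string over $(\Sigma,\Gamma)$ of length $n$. Then the total number of minimally $(y,d)$-unique substrings of $S$, summed over all colors $y\in\Gamma$ and all delays $d=0,1,\ldots,n$ (i.e. the number of triples $(T,y,d)$ with $y\in\Gamma$, $0\le d\le n$ and $T$ a minimally $(y,d)$-unique substring of $S$), is $\mathcal{O}(n^2)$.
   Context: A colored string over $(\Sigma,\Gamma)$ is a string $S=S[1,n]$ over the alphabet $\Sigma$ together with a coloring function $f:\{1,\ldots,n\}\to\Gamma$. For $i\le j$, $S[i,j]=S[i]\cdots S[j]$; if $i>j$, $S[i,j]$ is the empty string. A substring $U$ of $T$ is proper if $U\neq T$. An occurrence of a substring $T=T[1,m]$ of $S$ is a starting position $i$ with $S[i,i+m-1]=T$. Let $y\in\Gamma$ and $d\ge 0$ an integer. An occurrence $i$ of $T$ is $(y,d)$-good if $f(i+m-1+d)=y$. $T$ is $(y,d)$-unique if every occurrence $i$ of $T$ is $(y,d)$-good or satisfies $i+m-1+d>n$. $T$ is minimally $(y,d)$-unique if it is $(y,d)$-unique and there is no proper substring $U=T[i,j]$ of $T$ which is $(y,d')$-unique for $d'=d+|T|-j$. -}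

module Defs where

open import Data.Nat using (ℕ; zero; suc; _+_; _∸_; _≤_; _<_)
open import Data.Fin using (Fin; zero; suc)
open import Data.Vec using (Vec; toList)
open import Data.List using (List; length; take; drop)
open import Data.Maybe using (Maybe; just; nothing)
open import Data.Product using (_×_; ∃)
open import Data.Sum using (_⊎_)
open import Relation.Binary.PropositionalEquality using (_≡_; _≢_)
open import Relation.Nullary using (¬_)

-- Colored string over (Σ, Γ): S : Vec Σ n together with f : Fin n → Γ,
-- where position p ∈ {1,…,n} (1-based) is stored at index p - 1.

colorAt : {Γ : Set} {n : ℕ} → (Fin n → Γ) → ℕ → Maybe Γ
colorAt {n = zero}  f _             = nothing
colorAt {n = suc n} f zero          = nothing
colorAt {n = suc n} f (suc zero)    = just (f zero)
colorAt {n = suc n} f (suc (suc p)) = colorAt {n = n} (λ x → f (suc x)) (suc p)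

-- T[i,j] = T[i] ⋯ T[j] (1-based), empty if i > j.
sub : {A : Set} → List A → ℕ → ℕ → List A
sub T i j = take (suc j ∸ i) (drop (i ∸ 1) T)

Occ : {Σ : Set} {n : ℕ} → Vec Σ n → List Σ → ℕ → Set
Occ {n = n} S T i =
  (1 ≤ i) × (i + length T ≤ suc n) × (take (length T) (drop (i ∸ 1) (toList S)) ≡ T)

IsSubstring : {Σ : Set} {n : ℕ} → Vec Σ n → List Σ → Set
IsSubstring S T = ∃ λ i → Occ S T i

-- the position i + m - 1 + d (i ≥ 1 for occurrences)
target : ℕ → ℕ → ℕ → ℕ
target i m d = (i + m + d) ∸ 1

Good : {Γ : Set} {n : ℕ} → (Fin n → Γ) → Γ → ℕ → ℕ → ℕ → Set
Good f y d m i = colorAt f (target i m d) ≡ just y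

IsUnique : {Σ Γ : Set} {n : ℕ} → Vec Σ n → (Fin n → Γ) → List Σ → Γ → ℕ → Set
IsUnique {n = n} S f T y d =
  ∀ i → Occ S T i → Good f y d (length T) i ⊎ n < target i (length T) d

IsMinUnique : {Σ Γ : Set} {n : ℕ} → Vec Σ n → (Fin n → Γ) → List Σ → Γ → ℕ → Set
IsMinUnique S f T y d =
  IsUnique S f T y d ×
  (∀ i j → 1 ≤ i → j ≤ length T → sub T i j ≢ T →
     ¬ IsUnique S f (sub T i j) y (d + length T ∸ j))

{-# OPTIONS --safe #-}
module Submission where

open import Defs
open import Data.Nat using (ℕ; _*_; _^_; _≤_)
open import Data.Fin using (Fin)
open import Data.Vec using (Vec)
open import Data.List using (List; length)
open import Data.List.Relation.Unary.All using (All)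
open import Data.List.Relation.Unary.Unique.Propositional using (Unique)
open import Data.Product using (_×_; _,_; ∃)

open import Data.Nat using (zero; suc; _+_; _∸_; z≤n; s≤s; _≤?_)
open import Data.Nat.Properties
open import Data.Fin using (combine; fromℕ<)
import Data.Fin as Fin
open import Data.Fin.Properties using (pigeonhole; combine-injective; fromℕ<-injective)
  renaming (<⇒≢ to <⇒≢ᶠ)
open import Data.Vec using ([]; toList)
open import Data.List using ([]; _∷_; take; drop; lookup)
open import Data.List.Properties using (take-all; take-drop; drop-drop; drop-[]; take-[]; length-drop)
open import Data.List.Membership.Propositional.Properties using (∈-lookup)
open import Data.List.Relation.Unary.All using (_∷_)
import Data.List.Relation.Unary.All as All
open import Data.List.Relation.Unary.AllPairs using (_∷_)
open import Data.Sum using (inj₁; inj₂)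
open import Data.Maybe using (nothing)
open import Relation.Nullary using (¬_; yes; no; contradiction)
open import Relation.Binary.PropositionalEquality
open ≡-Reasoning
open import Data.Nat.Solver using (module +-*-Solver)
open +-*-Solver using (solve; _:+_; _:*_; _:^_; con; _:=_)

-- A minimally (y,d)-unique substring is determined by y, d and the end position of any one of
-- its occurrences: if two of them ended at the same position, the shorter would be a proper
-- suffix of the longer and (y,d)-unique with the same delay, contradicting minimality of the
-- longer. Coding each triple (T, y, d) by (y, d, end of an occurrence) is thus injective into a
-- set of size |Γ|(n+1)^2 ≤ 4|Γ|n^2 for n ≥ 1; for n = 0 no triple qualifies at all.

module _ {A : Set} where

  Unique⇒lookup-injective : ∀ {xs : List A} → Unique xs →
                            ∀ i j → lookup xs i ≡ lookup xs j → i ≡ j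
  Unique⇒lookup-injective (_ ∷ _)    Fin.zero    Fin.zero    _  = refl
  Unique⇒lookup-injective (x∉xs ∷ _) Fin.zero    (Fin.suc j) eq = contradiction eq (All.lookup x∉xs (∈-lookup j))
  Unique⇒lookup-injective (x∉xs ∷ _) (Fin.suc i) Fin.zero    eq = contradiction (sym eq) (All.lookup x∉xs (∈-lookup i))
  Unique⇒lookup-injective (_ ∷ u)    (Fin.suc i) (Fin.suc j) eq = cong Fin.suc (Unique⇒lookup-injective u i j eq)

  Unique⇒length≤ : ∀ {P : A → Set} {N : ℕ} (code : ∀ x → P x → Fin N) →
                   (∀ x y px py → code x px ≡ code y py → x ≡ y) →
                   ∀ {xs} → Unique xs → All P xs → length xs ≤ N
  Unique⇒length≤ {N = N} code code-injective {xs} u pxs with length xs ≤? N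
  ... | yes xs≤N = xs≤N
  ... | no xs≰N
    with i , j , i<j , eq ← pigeonhole (≰⇒> xs≰N) (λ i → code (lookup xs i) (All.lookup pxs (∈-lookup i)))
    = contradiction (Unique⇒lookup-injective u i j (code-injective _ _ _ _ eq)) (<⇒≢ᶠ i<j)

sub-suffix : ∀ {A : Set} j (T : List A) → sub T (suc j) (length T) ≡ drop j T
sub-suffix j T = take-all (length T ∸ j) (drop j T) (≤-reflexive (length-drop j T))

module _ {Σ Γ : Set} {n : ℕ} (S : Vec Σ n) (f : Fin n → Γ) where

  proper-suffix-not-unique : ∀ {T y d} j → IsMinUnique S f T y d → drop j T ≢ T →
                             ¬ IsUnique S f (drop j T) y d
  proper-suffix-not-unique {T} {y} {d} j (_ , minimal) proper unique =
    minimal (suc j) (length T) (s≤s z≤n) ≤-refl (subst (_≢ T) (sym (sub-suffix j T)) proper)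
      (subst₂ (λ U e → IsUnique S f U y e) (sym (sub-suffix j T)) (sym (m+n∸n≡m d (length T))) unique)

  common-end⇒suffix : ∀ {T T' i i'} → Occ S T i → Occ S T' i' →
                      i + length T ≡ i' + length T' → length T ≤ length T' →
                      drop (length T' ∸ length T) T' ≡ T
  common-end⇒suffix {T} {T'} {suc p} {suc p'} (_ , _ , T-window) (_ , _ , T'-window) same-end m≤m' =
    begin
      drop j T'                            ≡⟨ cong (drop j) T'-window ⟨
      drop j (take m' (drop p' s))         ≡⟨ cong (λ l → drop j (take l (drop p' s))) (m∸n+n≡m m≤m') ⟨
      drop j (take (j + m) (drop p' s))    ≡⟨ take-drop m j (drop p' s) ⟨
      take m (drop j (drop p' s))          ≡⟨ cong (take m) (drop-drop p' j s) ⟩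
      take m (drop (p' + j) s)             ≡⟨ cong (λ q → take m (drop q s)) p≡p'+j ⟨
      take m (drop p s)                    ≡⟨ T-window ⟩
      T                                    ∎
    where
    s = toList S
    m = length T
    m' = length T'
    j = m' ∸ m
    p≡p'+j : p ≡ p' + j
    p≡p'+j = +-cancelʳ-≡ m p (p' + j) (begin
      p + m        ≡⟨ suc-injective same-end ⟩
      p' + m'      ≡⟨ cong (p' +_) (m∸n+n≡m m≤m') ⟨
      p' + (j + m) ≡⟨ +-assoc p' j m ⟨
      p' + j + m   ∎)

  min-unique-common-end≤ : ∀ {T T' i i' y d} → Occ S T i → Occ S T' i' →
                           i + length T ≡ i' + length T' → length T ≤ length T' →
                           IsMinUnique S f T y d → IsMinUnique S f T' y d → T ≡ T'
  min-unique-common-end≤ {T} {T'} {y = y} {d} occ occ' same-end m≤m' (unique , _) min'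
    with m≤n⇒m<n∨m≡n m≤m'
  ... | inj₁ m<m' = contradiction (subst (λ U → IsUnique S f U y d) (sym suffix) unique)
                                  (proper-suffix-not-unique j min' proper)
    where
    j = length T' ∸ length T
    suffix = common-end⇒suffix occ occ' same-end m≤m'
    proper : drop j T' ≢ T'
    proper eq = <⇒≢ m<m' (cong length (trans (sym suffix) eq))
  ... | inj₂ m≡m' = begin
      T                                ≡⟨ common-end⇒suffix occ occ' same-end m≤m' ⟨
      drop (length T' ∸ length T) T'   ≡⟨ cong (λ j → drop j T') (trans (cong (length T' ∸_) m≡m') (n∸n≡0 (length T'))) ⟩
      T'                               ∎

  min-unique-common-end : ∀ {T T' i i' y d} → Occ S T i → Occ S T' i' →
                          i + length T ≡ i' + length T' →
                          IsMinUnique S f T y d → IsMinUnique S f T' y d → T ≡ T'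
  min-unique-common-end {T} {T'} occ occ' same-end min min' with ≤-total (length T) (length T')
  ... | inj₁ m≤m' = min-unique-common-end≤ occ occ' same-end m≤m' min min'
  ... | inj₂ m'≤m = sym (min-unique-common-end≤ occ' occ (sym same-end) m'≤m min' min)

module _ {Σ : Set} {g n : ℕ} where

  MinUniqueTriple : Vec Σ n → (Fin n → Fin g) → List Σ × Fin g × ℕ → Set
  MinUniqueTriple S f (T , y , d) = d ≤ n × IsSubstring S T × IsMinUnique S f T y d

  triple-code : ∀ {S f} x → MinUniqueTriple S f x → Fin (g * (suc n * suc n))
  triple-code (T , y , d) (d≤n , (suc p , _ , p+m<1+n , _) , _) =
    combine y (combine (fromℕ< (s≤s d≤n)) (fromℕ< p+m<1+n))

  triple-code-injective : ∀ {S f} x x' (px : MinUniqueTriple S f x) (px' : MinUniqueTriple S f x') →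
                          triple-code x px ≡ triple-code x' px' → x ≡ x'
  triple-code-injective {S} {f} (T , y , d) (T' , y' , d')
    (d≤n , (suc p , occ) , min) (d'≤n , (suc p' , occ') , min') eq
    with refl , eq' ← combine-injective y _ y' _ eq
    with d-eq , end-eq ← combine-injective _ _ _ _ eq'
    with refl ← fromℕ<-injective d d' _ _ d-eq
    = cong (λ U → U , y , d)
        (min-unique-common-end S f occ occ' (cong suc (fromℕ<-injective _ _ _ _ end-eq)) min min')

module _ {Σ : Set} where

  -- The empty string occurs at i = 1, whose target position i + 0 - 1 + 0 = 0 is never coloured.
  empty-not-unique : ∀ {Γ n} (S : Vec Σ n) (f : Fin n → Γ) y → ¬ IsUnique S f [] y 0
  empty-not-unique {Γ} {n} S f y unique with unique 1 (s≤s z≤n , s≤s z≤n , refl)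
  ... | inj₁ good = contradiction (trans (sym (colorAt-0 n)) good) λ ()
    where
    colorAt-0 : ∀ n {f : Fin n → Γ} → colorAt f 0 ≡ nothing
    colorAt-0 zero    = refl
    colorAt-0 (suc n) = refl

  substring-of-empty : ∀ {T} → IsSubstring {Σ} [] T → T ≡ []
  substring-of-empty {T} (i , _ , _ , window) = begin
    T                                 ≡⟨ window ⟨
    take (length T) (drop (i ∸ 1) []) ≡⟨ cong (take (length T)) (drop-[] (i ∸ 1)) ⟩
    take (length T) []                ≡⟨ take-[] (length T) ⟩
    []                                ∎

no-min-unique-triple-in-empty : ∀ {Σ g} (f : Fin 0 → Fin g) x → ¬ MinUniqueTriple {Σ} [] f x
no-min-unique-triple-in-empty f (T , y , .0) (z≤n , T∈[] , unique , _) =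
  empty-not-unique [] f y (subst (λ U → IsUnique [] f U y 0) (substring-of-empty T∈[]) unique)

code-space-bound : ∀ g m → g * (suc (suc m) * suc (suc m)) ≤ 4 * g * suc m ^ 2
code-space-bound g m =
  ≤-trans (*-monoʳ-≤ g (*-mono-≤ 1+a≤a+a 1+a≤a+a)) (≤-reflexive (identity g (suc m)))
  where
  1+a≤a+a : suc (suc m) ≤ suc m + suc m
  1+a≤a+a = +-monoˡ-≤ (suc m) (s≤s z≤n)
  identity : ∀ g a → g * ((a + a) * (a + a)) ≡ 4 * g * a ^ 2
  identity = solve 2 (λ g a → g :* ((a :+ a) :* (a :+ a)) := con 4 :* g :* (a :^ 2)) refl

lemma1 : (k g : ℕ) → ∃ λ (C : ℕ) → ∀ (n : ℕ) (S : Vec (Fin k) n) (f : Fin n → Fin g)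
    (L : List (List (Fin k) × Fin g × ℕ)) → Unique L →
    All (λ { (T , y , d) → d ≤ n × IsSubstring S T × IsMinUnique S f T y d }) L →
    length L ≤ C * n ^ 2
lemma1 k g = 4 * g , bound
  where
  bound : ∀ n (S : Vec (Fin k) n) f L → Unique L → All (MinUniqueTriple S f) L → length L ≤ 4 * g * n ^ 2
  bound zero    S  f []      _ _        = z≤n
  bound zero    [] f (x ∷ _) _ (px ∷ _) = contradiction px (no-min-unique-triple-in-empty f x)
  bound (suc m) S  f L       unique pxs =
    ≤-trans (Unique⇒length≤ triple-code triple-code-injective unique pxs) (code-space-bound g m)
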